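{- Let $f(r)$ denote the minimum number of edges of an $r$-partite intersecting hypergraph $\mathcal{H}$ with $\tau(\mathcal{H}) \ge r-1$. Then, as $r \to \infty$, $$f(r) \ge \left(3-\frac{1}{\sqrt{18}}\right) r\,(1-o(1)).$$
   Context: A hypergraph is $r$-partite if its vertex set can be partitioned into $r$ parts such that every edge contains exactly one vertex from each part. A hypergraph is intersecting if every two edges have nonempty intersection. The cover number $\tau(\mathcal{H})$ is the minimum size of a set of vertices meeting every edge of $\mathcal{H}$. The term $o(1)$ denotes a quantity tending to $0$ as $r\to\infty$. -}

module Defs where

open import Data.Nat using (ℕ; _≤_)
open import Data.Fin using (Fin)
open import Data.Vec using (Vec; lookup)
open import Data.Product using (_×_; _,_; ∃-syntax)
open import Data.List using (List; length)
open import Data.List.Membership.Propositional using (_∈_)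
open import Data.List.Relation.Unary.Any using (Any)
open import Relation.Binary.PropositionalEquality using (_≡_)

-- The vertices of
-- part i are the pairs (i , v) with v : ℕ; an edge picks exactly one vertex
-- from each part, so it is a vector e : Vec ℕ r (vertex (i , lookup e i)).
Edge : ℕ → Set
Edge r = Vec ℕ r

Vertex : ℕ → Set
Vertex r = Fin r × ℕ

_∈ᵉ_ : ∀ {r} → Vertex r → Edge r → Set
(i , v) ∈ᵉ e = lookup e i ≡ v

-- A hypergraph is a list of edges (distinctness imposed separately via Unique).
Hypergraph : ℕ → Set
Hypergraph r = List (Edge r)

Intersecting : ∀ {r} → Hypergraph r → Set
Intersecting {r} H = ∀ e f → e ∈ H → f ∈ H → ∃[ i ] (lookup e i ≡ lookup f i)

Covers : ∀ {r} → List (Vertex r) → Hypergraph r → Set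
Covers C H = ∀ e → e ∈ H → Any (λ x → x ∈ᵉ e) C

CoverNumberAtLeast : ∀ {r} → Hypergraph r → ℕ → Set
CoverNumberAtLeast {r} H k =
  ∀ (C : List (Vertex r)) → Covers C H → k ≤ length C

module Submission where

-- Every intersecting r-partite hypergraph H with τ(H) ≥ r − 1 has at least
-- (a/b)·r edges whenever a/b < 3 − 1/√18 and r ≥ 400.  In fact we show
-- |H| ≥ 2.8r − 10 ≥ 2.77r, and 3 − 1/√18 < 2.77.
--
-- Let F be intersecting with t edges, τ(F) ≥ K and all
-- vertex degrees ≤ D.  Count triples (part, edge, edge) in which the two edges
-- share their vertex of that part.  Every edge agrees with itself in r parts
-- and with every other edge somewhere, so there are at least t(t + r) − t.
-- Part by part the count is Σ deg², and the vertices of a part on edges of F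
-- cover F, so there are at least K of them; (d − 1)(d − D) ≤ 0 then bounds
-- each part by (D + 1)t − DK.  Hence  t² + rDK ≤ rDt + t.
--
-- Deleting the edges through a vertex of maximum degree D
-- lowers τ by at most one and t by D.  By the degree inequality D ≥ 3 once
-- 2K ≥ r + 2, D ≥ 4 once 4K ≥ 3r + 3, and D ≥ 5 once 20K ≥ 19r; together with
-- 2K ≤ t + 1 this yields, by induction on K, a linear lower bound on t in each
-- of these phases, and the last one at K = r − 1 gives the claim.

open import Defs
open import Data.Nat using (ℕ; zero; suc; _+_; _*_; _∸_; _≤_; _<_; z≤n; s≤s; _≟_; _≤?_; _<?_)
open import Data.Nat.Properties
open import Data.Nat.Tactic.RingSolver using (solve-∀)
open import Algebra.Properties.CommutativeSemigroup +-commutativeSemigroup using (x∙yz≈y∙xz)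
open import Data.Empty using (⊥; ⊥-elim)
open import Data.Sum using (inj₁; inj₂)
open import Data.Product using (∃-syntax; Σ-syntax; _×_; _,_; proj₁; proj₂)
open import Data.Fin using (Fin)
open import Data.Vec using (lookup)
open import Data.List using (List; []; _∷_; length; filter; map; allFin; cartesianProductWith)
open import Data.List.Properties using (filter-accept; filter-reject; length-tabulate; length-map)
open import Data.List.Extrema.Nat using (argmax; f[xs]≤f[argmax])
open import Data.List.Membership.Propositional using (_∈_)
open import Data.List.Membership.Propositional.Properties
  using (∈-filter⁺; ∈-filter⁻; ∈-allFin; ∈-map⁺; ∈-cartesianProductWith⁺)
open import Data.List.Relation.Unary.Any using (here; there)
import Data.List.Relation.Unary.Any as Any
import Data.List.Relation.Unary.All as All
open import Data.List.Relation.Unary.Unique.Propositional using (Unique)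
open import Function using (id)
open import Relation.Binary.PropositionalEquality
open import Relation.Nullary using (Dec; yes; no; ¬_; ¬?)

∑ : {A : Set} → List A → (A → ℕ) → ℕ
∑ [] f = 0
∑ (x ∷ xs) f = f x + ∑ xs f

syntax ∑ xs (λ x → e) = ∑[ x ← xs ] e

∑-cong : {A : Set} {f g : A → ℕ} (xs : List A) →
  (∀ x → x ∈ xs → f x ≡ g x) → ∑ xs f ≡ ∑ xs g
∑-cong [] _ = refl
∑-cong (x ∷ xs) eq = cong₂ _+_ (eq x (here refl)) (∑-cong xs (λ y y∈ → eq y (there y∈)))

∑-mono : {A : Set} {f g : A → ℕ} (xs : List A) →
  (∀ x → x ∈ xs → f x ≤ g x) → ∑ xs f ≤ ∑ xs g
∑-mono [] _ = z≤n
∑-mono (x ∷ xs) le = +-mono-≤ (le x (here refl)) (∑-mono xs (λ y y∈ → le y (there y∈)))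

∑-const : {A : Set} (xs : List A) (c : ℕ) → ∑[ _ ← xs ] c ≡ length xs * c
∑-const [] c = refl
∑-const (x ∷ xs) c = cong (c +_) (∑-const xs c)

∑-+ : {A : Set} (xs : List A) (f g : A → ℕ) →
  ∑[ x ← xs ] (f x + g x) ≡ ∑ xs f + ∑ xs g
∑-+ [] f g = refl
∑-+ (x ∷ xs) f g = trans (cong (f x + g x +_) (∑-+ xs f g)) (shuffle (f x) (g x) _ _)
  where
  shuffle : ∀ a b c d → a + b + (c + d) ≡ a + c + (b + d)
  shuffle = solve-∀

∑-swap : {A B : Set} (xs : List A) (ys : List B) (g : A → B → ℕ) →
  ∑[ x ← xs ] ∑[ y ← ys ] g x y ≡ ∑[ y ← ys ] ∑[ x ← xs ] g x y
∑-swap [] ys g = sym (trans (∑-const ys 0) (*-zeroʳ (length ys)))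
∑-swap (x ∷ xs) ys g = trans (cong (∑ ys (g x) +_) (∑-swap xs ys g))
  (sym (∑-+ ys (g x) (λ y → ∑[ x′ ← xs ] g x′ y)))

term≤∑ : {A : Set} (f : A → ℕ) {x : A} (xs : List A) → x ∈ xs → f x ≤ ∑ xs f
term≤∑ f (y ∷ xs) (here refl) = m≤m+n _ _
term≤∑ f (y ∷ xs) (there x∈) = ≤-trans (term≤∑ f xs x∈) (m≤n+m _ _)

length≤∑ : {A : Set} (f : A → ℕ) (xs : List A) → (∀ y → y ∈ xs → 1 ≤ f y) → length xs ≤ ∑ xs f
length≤∑ f [] _ = z≤n
length≤∑ f (x ∷ xs) pos = +-mono-≤ (pos x (here refl)) (length≤∑ f xs (λ y y∈ → pos y (there y∈)))

∑-peak : {A : Set} (f : A → ℕ) {x : A} (xs : List A) → x ∈ xs →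
  (∀ y → y ∈ xs → 1 ≤ f y) → length xs + f x ≤ ∑ xs f + 1
∑-peak f (y ∷ xs) (here refl) pos = begin
  suc (length xs + f y)   ≤⟨ s≤s (+-monoˡ-≤ (f y) (length≤∑ f xs (λ z z∈ → pos z (there z∈)))) ⟩
  suc (∑ xs f + f y)      ≡⟨ cong suc (+-comm (∑ xs f) (f y)) ⟩
  suc (f y + ∑ xs f)      ≡⟨ +-comm 1 _ ⟩
  f y + ∑ xs f + 1        ∎
  where open ≤-Reasoning
∑-peak f {x} (y ∷ xs) (there x∈) pos = begin
  suc (length xs + f x)   ≤⟨ s≤s (∑-peak f xs x∈ (λ z z∈ → pos z (there z∈))) ⟩
  suc (∑ xs f + 1)        ≤⟨ +-monoˡ-≤ _ (pos y (here refl)) ⟩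
  f y + (∑ xs f + 1)      ≡⟨ +-assoc (f y) _ 1 ⟨
  f y + ∑ xs f + 1        ∎
  where open ≤-Reasoning

𝟙 : {P : Set} → Dec P → ℕ
𝟙 (yes _) = 1
𝟙 (no _) = 0

𝟙-yes : {P : Set} (d : Dec P) → P → 𝟙 d ≡ 1
𝟙-yes (yes _) _ = refl
𝟙-yes (no ¬p) p = ⊥-elim (¬p p)

𝟙-no : {P : Set} (d : Dec P) → ¬ P → 𝟙 d ≡ 0
𝟙-no (yes p) ¬p = ⊥-elim (¬p p)
𝟙-no (no _) _ = refl

-- A class of c equal keys with 1 ≤ c ≤ D satisfies c² + D ≤ (D + 1)c,
-- i.e. (c − 1)(D − c) ≥ 0.
class-cost : ∀ c D → 1 ≤ c → c ≤ D → c * c + D ≤ D * c + c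
class-cost (suc c) D _ c<D with m≤n⇒∃[o]m+o≡n c<D
... | e , refl = subst (suc c * suc c + (suc c + e) ≤_) (expand c e) (m≤m+n _ (e * c))
  where
  expand : ∀ c e → suc c * suc c + (suc c + e) + e * c ≡ (suc c + e) * suc c + suc c
  expand = solve-∀

-- Adding the contribution of one class of size c to a bound for the others:
-- with s collisions and u keys among l members, the bound  s + Du ≤ (D + 1)l
-- extends to c more members, c² more collisions and one more key.
class-step : ∀ D c l s u → c * c + D ≤ D * c + c → s + D * u ≤ D * l + l →
  c * c + s + D * suc u ≤ D * (c + l) + (c + l)
class-step D c l s u class rest = begin
  c * c + s + D * suc u          ≡⟨ regroup (c * c) D s u ⟩
  (c * c + D) + (s + D * u)      ≤⟨ +-mono-≤ class rest ⟩
  (D * c + c) + (D * l + l)      ≡⟨ distribute D c l ⟩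
  D * (c + l) + (c + l)          ∎
  where
  open ≤-Reasoning
  regroup : ∀ q d s u → q + s + d * suc u ≡ (q + d) + (s + d * u)
  regroup = solve-∀
  distribute : ∀ d c l → (d * c + c) + (d * l + l) ≡ d * (c + l) + (c + l)
  distribute = solve-∀

-- Multiplicities in a list whose members carry a natural-number key κ.
-- For a hypergraph and κ = the coordinate in part i, these are the
-- degrees of the vertices of part i.
module Keyed {X : Set} (κ : X → ℕ) where

  mult : ℕ → List X → ℕ
  mult y L = ∑[ x ← L ] 𝟙 (κ x ≟ y)

  without : ℕ → List X → List X
  without y = filter (λ x → ¬? (κ x ≟ y))

  collisions : List X → ℕ
  collisions L = ∑[ x ← L ] mult (κ x) L

  mult-pos : ∀ {x} L → x ∈ L → 1 ≤ mult (κ x) L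
  mult-pos {x} L x∈ = subst (_≤ mult (κ x) L) (𝟙-yes (κ x ≟ κ x) refl)
                        (term≤∑ (λ z → 𝟙 (κ z ≟ κ x)) L x∈)

  without-drop : ∀ {x y} L → κ x ≡ y → without y (x ∷ L) ≡ without y L
  without-drop L κx≡y = filter-reject (λ x → ¬? (κ x ≟ _)) (λ κx≢y → κx≢y κx≡y)

  without-keep : ∀ {x y} L → κ x ≢ y → without y (x ∷ L) ≡ x ∷ without y L
  without-keep L κx≢y = filter-accept (λ x → ¬? (κ x ≟ _)) κx≢y

  length-without : ∀ y L → length L ≡ mult y L + length (without y L)
  length-without y [] = refl
  length-without y (x ∷ L) with κ x ≟ y
  ... | yes κx≡y rewrite without-drop L κx≡y = cong suc (length-without y L)
  ... | no κx≢y rewrite without-keep L κx≢y =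
    trans (cong suc (length-without y L)) (sym (+-suc _ _))

  mult-without : ∀ {y z} L → z ≢ y → mult z (without y L) ≡ mult z L
  mult-without [] _ = refl
  mult-without {y} {z} (x ∷ L) z≢y with κ x ≟ y
  ... | yes κx≡y rewrite without-drop L κx≡y = trans (mult-without L z≢y)
                     (cong (_+ mult z L) (sym (𝟙-no (κ x ≟ z) (λ κx≡z → z≢y (trans (sym κx≡z) κx≡y)))))
  ... | no κx≢y rewrite without-keep L κx≢y = cong (𝟙 (κ x ≟ z) +_) (mult-without L z≢y)

  ∈-without⁻ : ∀ {x y} L → x ∈ without y L → x ∈ L × κ x ≢ y
  ∈-without⁻ {y = y} L = ∈-filter⁻ (λ x → ¬? (κ x ≟ y)) {xs = L}

  ∈-without⁺ : ∀ {x y} L → x ∈ L → κ x ≢ y → x ∈ without y L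
  ∈-without⁺ {y = y} L = ∈-filter⁺ (λ x → ¬? (κ x ≟ y)) {xs = L}

  ∑-split : ∀ y L M → ∑[ x ← L ] mult (κ x) M ≡ mult y L * mult y M + ∑[ x ← without y L ] mult (κ x) M
  ∑-split y [] M = refl
  ∑-split y (x ∷ L) M with κ x ≟ y
  ... | yes κx≡y rewrite without-drop L κx≡y | κx≡y =
    trans (cong (mult y M +_) (∑-split y L M))
      (sym (+-assoc (mult y M) (mult y L * mult y M) (∑[ z ← without y L ] mult (κ z) M)))
  ... | no κx≢y rewrite without-keep L κx≢y =
    trans (cong (mult (κ x) M +_) (∑-split y L M))
      (x∙yz≈y∙xz (mult (κ x) M) (mult y L * mult y M) (∑[ z ← without y L ] mult (κ z) M))

  collisions-without : ∀ y L → collisions L ≡ mult y L * mult y L + collisions (without y L)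
  collisions-without y L = trans (∑-split y L L) (cong (mult y L * mult y L +_)
    (∑-cong (without y L) (λ x x∈ → sym (mult-without L (proj₂ (∈-without⁻ L x∈))))))

  -- Grouping L into classes of equal keys, each of size at most D: some list U
  -- of keys, containing the key of every member, has
  --   collisions L + D·|U| ≤ (D + 1)·|L|,
  -- since a class of size c (1 ≤ c ≤ D) contributes c² ≤ (D + 1)c − D.
  class-bound : ∀ D L → (∀ x → x ∈ L → mult (κ x) L ≤ D) →
    ∃[ U ] (∀ x → x ∈ L → κ x ∈ U) × (collisions L + D * length U ≤ D * length L + length L)
  class-bound D L = go (length L) L ≤-refl
    where
    -- induction on the number of members, removing one class at a time
    go : ∀ n L → length L ≤ n → (∀ x → x ∈ L → mult (κ x) L ≤ D) →
      ∃[ U ] (∀ x → x ∈ L → κ x ∈ U) × (collisions L + D * length U ≤ D * length L + length L)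
    go n [] _ _ = [] , (λ _ ()) , ≤-reflexive (sym (+-identityʳ (D * 0)))
    go (suc n) L@(x ∷ L′) (s≤s |L′|≤n) bounded = κ x ∷ U₂ , covers , bound
      where
      y = κ x
      c = mult y L
      L₂ = without y L
      |L|≡c+|L₂| : length L ≡ c + length L₂
      |L|≡c+|L₂| = length-without y L
      1≤c : 1 ≤ c
      1≤c = mult-pos L (here refl)
      |L₂|≤n : length L₂ ≤ n
      |L₂|≤n = ≤-pred (begin
        suc (length L₂)  ≤⟨ +-monoˡ-≤ (length L₂) 1≤c ⟩
        c + length L₂    ≡⟨ |L|≡c+|L₂| ⟨
        length L         ≤⟨ s≤s |L′|≤n ⟩
        suc n            ∎)
        where open ≤-Reasoning
      rest = go n L₂ |L₂|≤n (λ z z∈ → subst (_≤ D) (sym (mult-without L (proj₂ (∈-without⁻ L z∈))))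
                                         (bounded z (proj₁ (∈-without⁻ L z∈))))
      U₂ = proj₁ rest
      covers : ∀ z → z ∈ L → κ z ∈ y ∷ U₂
      covers z z∈ with κ z ≟ y
      ... | yes κz≡y = here κz≡y
      ... | no κz≢y = there (proj₁ (proj₂ rest) z (∈-without⁺ L z∈ κz≢y))
      bound : collisions L + D * suc (length U₂) ≤ D * length L + length L
      bound = begin
        collisions L + D * suc (length U₂)
          ≡⟨ cong (_+ D * suc (length U₂)) (collisions-without y L) ⟩
        c * c + collisions L₂ + D * suc (length U₂)
          ≤⟨ class-step D c (length L₂) (collisions L₂) (length U₂)
               (class-cost c D 1≤c (bounded x (here refl))) (proj₂ (proj₂ rest)) ⟩
        D * (c + length L₂) + (c + length L₂)
          ≡⟨ cong (λ l → D * l + l) |L|≡c+|L₂| ⟨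
        D * length L + length L ∎
        where open ≤-Reasoning

module _ {r : ℕ} where

  part : Fin r → Edge r → ℕ
  part i e = lookup e i

  deg : Vertex r → Hypergraph r → ℕ
  deg (i , y) = Keyed.mult (part i) y

  MaxDegree : Hypergraph r → ℕ → Set
  MaxDegree F D = ∀ i e → e ∈ F → deg (i , lookup e i) F ≤ D

  agree : Edge r → Edge r → ℕ
  agree e f = ∑[ i ← allFin r ] 𝟙 (lookup f i ≟ lookup e i)

  agree-self : ∀ e → agree e e ≡ r
  agree-self e = begin
    ∑[ i ← allFin r ] 𝟙 (lookup e i ≟ lookup e i)
      ≡⟨ ∑-cong (allFin r) (λ i _ → 𝟙-yes (lookup e i ≟ lookup e i) refl) ⟩
    ∑[ i ← allFin r ] 1                             ≡⟨ ∑-const (allFin r) 1 ⟩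
    length (allFin r) * 1                           ≡⟨ *-identityʳ _ ⟩
    length (allFin r)                               ≡⟨ length-tabulate id ⟩
    r                                               ∎
    where open ≡-Reasoning

  agree-pos : ∀ e f → ∃[ i ] (lookup e i ≡ lookup f i) → 1 ≤ agree e f
  agree-pos e f (i , eᵢ≡fᵢ) = subst (_≤ agree e f) (𝟙-yes (lookup f i ≟ lookup e i) (sym eᵢ≡fᵢ))
    (term≤∑ (λ j → 𝟙 (lookup f j ≟ lookup e j)) (allFin r) (∈-allFin i))

  collisions-by-parts : ∀ F →
    ∑[ i ← allFin r ] Keyed.collisions (part i) F ≡ ∑[ e ← F ] ∑[ f ← F ] agree e f
  collisions-by-parts F = begin
    ∑[ i ← allFin r ] ∑[ e ← F ] ∑[ f ← F ] 𝟙 (lookup f i ≟ lookup e i)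
      ≡⟨ ∑-swap (allFin r) F (λ i e → ∑[ f ← F ] 𝟙 (lookup f i ≟ lookup e i)) ⟩
    ∑[ e ← F ] ∑[ i ← allFin r ] ∑[ f ← F ] 𝟙 (lookup f i ≟ lookup e i)
      ≡⟨ ∑-cong F (λ e _ → ∑-swap (allFin r) F (λ i f → 𝟙 (lookup f i ≟ lookup e i))) ⟩
    ∑[ e ← F ] ∑[ f ← F ] agree e f ∎
    where open ≡-Reasoning

  -- Lower bound: each edge agrees with itself in r parts and with every
  -- other edge in at least one part.
  agreements-lower : ∀ F → Intersecting F →
    length F * (length F + r) ≤ ∑[ e ← F ] ∑[ f ← F ] agree e f + length F
  agreements-lower F int = begin
    length F * (length F + r)             ≡⟨ ∑-const F (length F + r) ⟨
    ∑[ e ← F ] (length F + r)             ≤⟨ ∑-mono F row ⟩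
    ∑[ e ← F ] (∑[ f ← F ] agree e f + 1) ≡⟨ ∑-+ F (λ e → ∑[ f ← F ] agree e f) (λ _ → 1) ⟩
    ∑[ e ← F ] ∑[ f ← F ] agree e f + ∑[ _ ← F ] 1
      ≡⟨ cong (∑[ e ← F ] ∑[ f ← F ] agree e f +_) (trans (∑-const F 1) (*-identityʳ _)) ⟩
    ∑[ e ← F ] ∑[ f ← F ] agree e f + length F ∎
    where
    open ≤-Reasoning
    row : ∀ e → e ∈ F → length F + r ≤ ∑[ f ← F ] agree e f + 1
    row e e∈ = subst (λ a → length F + a ≤ ∑[ f ← F ] agree e f + 1) (agree-self e)
      (∑-peak (agree e) F e∈ (λ f f∈ → agree-pos e f (int e f e∈ f∈)))

  -- Upper bound in a single part i: the vertices of part i on edges of F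
  -- form a cover, so there are at least K of them.
  collisions-upper : ∀ F i D K → CoverNumberAtLeast F K →
    (∀ e → e ∈ F → deg (i , lookup e i) F ≤ D) →
    Keyed.collisions (part i) F + D * K ≤ D * length F + length F
  collisions-upper F i D K τ≥K bounded with Keyed.class-bound (part i) D F bounded
  ... | U , keys , bound = ≤-trans (+-monoʳ-≤ _ (*-monoʳ-≤ D K≤|U|)) bound
    where
    cover : Covers (map (i ,_) U) F
    cover f f∈ = Any.map (λ { refl → refl }) (∈-map⁺ (i ,_) (keys f f∈))
    K≤|U| : K ≤ length U
    K≤|U| = subst (K ≤_) (length-map (i ,_) U) (τ≥K (map (i ,_) U) cover)

  agreements-upper : ∀ F D K → CoverNumberAtLeast F K → MaxDegree F D →
    ∑[ e ← F ] ∑[ f ← F ] agree e f + r * (D * K) ≤ r * (D * length F + length F)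
  agreements-upper F D K τ≥K max = begin
    ∑[ e ← F ] ∑[ f ← F ] agree e f + r * (D * K)
      ≡⟨ cong₂ (λ a p → a + p * (D * K)) (collisions-by-parts F) |parts| ⟨
    ∑[ i ← parts ] Keyed.collisions (part i) F + length parts * (D * K)
      ≡⟨ cong (∑[ i ← parts ] Keyed.collisions (part i) F +_) (∑-const parts (D * K)) ⟨
    ∑[ i ← parts ] Keyed.collisions (part i) F + ∑[ _ ← parts ] (D * K)
      ≡⟨ ∑-+ parts (λ i → Keyed.collisions (part i) F) (λ _ → D * K) ⟨
    ∑[ i ← parts ] (Keyed.collisions (part i) F + D * K)
      ≤⟨ ∑-mono parts (λ i _ → collisions-upper F i D K τ≥K (max i)) ⟩
    ∑[ _ ← parts ] (D * length F + length F)
      ≡⟨ trans (∑-const parts _) (cong (_* (D * length F + length F)) |parts|) ⟩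
    r * (D * length F + length F) ∎
    where
    open ≤-Reasoning
    parts = allFin r
    |parts| : length parts ≡ r
    |parts| = length-tabulate id

  degree-inequality : ∀ F D K → Intersecting F → CoverNumberAtLeast F K → MaxDegree F D →
    length F * length F + r * D * K ≤ r * D * length F + length F
  degree-inequality F D K int τ≥K max = +-cancelˡ-≤ (t * r) _ _ (begin
    t * r + (t * t + r * D * K)      ≡⟨ regroup₁ t r D K ⟩
    t * (t + r) + r * (D * K)        ≤⟨ +-monoˡ-≤ (r * (D * K)) (agreements-lower F int) ⟩
    agreements + t + r * (D * K)     ≡⟨ regroup₂ agreements t (r * (D * K)) ⟩
    agreements + r * (D * K) + t     ≤⟨ +-monoˡ-≤ t (agreements-upper F D K τ≥K max) ⟩
    r * (D * t + t) + t              ≡⟨ regroup₃ r D t ⟩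
    t * r + (r * D * t + t)          ∎)
    where
    open ≤-Reasoning
    t = length F
    agreements = ∑[ e ← F ] ∑[ f ← F ] agree e f
    regroup₁ : ∀ t r D K → t * r + (t * t + r * D * K) ≡ t * (t + r) + r * (D * K)
    regroup₁ = solve-∀
    regroup₂ : ∀ a b c → a + b + c ≡ a + c + b
    regroup₂ = solve-∀
    regroup₃ : ∀ r D t → r * (D * t + t) + t ≡ t * r + (r * D * t + t)
    regroup₃ = solve-∀

  _∖_ : Hypergraph r → Vertex r → Hypergraph r
  F ∖ (i , y) = Keyed.without (part i) y F

  ∖-size : ∀ F v → length F ≡ deg v F + length (F ∖ v)
  ∖-size F (i , y) = Keyed.length-without (part i) y F

  ∖-intersecting : ∀ F v → Intersecting F → Intersecting (F ∖ v)
  ∖-intersecting F (i , y) int e f e∈ f∈ =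
    int e f (proj₁ (Keyed.∈-without⁻ (part i) F e∈)) (proj₁ (Keyed.∈-without⁻ (part i) F f∈))

  -- Deleting the edges through one vertex lowers the cover number by at most one:
  -- a cover of F ∖ v together with v covers F.
  ∖-cover : ∀ F v k → CoverNumberAtLeast F (suc k) → CoverNumberAtLeast (F ∖ v) k
  ∖-cover F (i , y) k τ≥ C covers = ≤-pred (τ≥ ((i , y) ∷ C) covers′)
    where
    covers′ : Covers ((i , y) ∷ C) F
    covers′ f f∈ with lookup f i ≟ y
    ... | yes fᵢ≡y = here fᵢ≡y
    ... | no fᵢ≢y = there (covers f (Keyed.∈-without⁺ (part i) F f∈ fᵢ≢y))

  nonempty : ∀ F k → CoverNumberAtLeast F (suc k) → Σ[ e ∈ Edge r ] e ∈ F
  nonempty [] k τ≥ with τ≥ [] (λ _ ())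
  ... | ()
  nonempty (e ∷ F) _ _ = e , here refl

  max-vertex : ∀ F {e₀} → Intersecting F → e₀ ∈ F → ∃[ v ] MaxDegree F (deg v F)
  max-vertex F {e₀} int e₀∈ = argmax (λ v → deg v F) v₀ candidates , maximal
    where
    candidates = cartesianProductWith (λ i e → (i , lookup e i)) (allFin r) F
    i₀ = proj₁ (int e₀ e₀ e₀∈ e₀∈)
    v₀ = (i₀ , lookup e₀ i₀)
    maximal : MaxDegree F (deg (argmax (λ v → deg v F) v₀ candidates) F)
    maximal i e e∈ = All.lookup (f[xs]≤f[argmax] {f = λ v → deg v F} v₀ candidates)
      (∈-cartesianProductWith⁺ (λ i e → (i , lookup e i)) (∈-allFin i) e∈)

  -- Pairing up the edges: any two edges share a vertex, so an intersecting
  -- hypergraph with t edges has a cover with at most ⌈t/2⌉ vertices.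
  pair-cover : ∀ F → Intersecting F →
    Σ[ C ∈ List (Vertex r) ] Covers C F × (length C + length C ≤ suc (length F))
  pair-cover [] _ = [] , (λ _ ()) , z≤n
  pair-cover (e ∷ []) int with int e e (here refl) (here refl)
  ... | i , _ = (i , lookup e i) ∷ [] , (λ { f (here refl) → here refl }) , s≤s (s≤s z≤n)
  pair-cover (e ∷ f ∷ F) int with int e f (here refl) (there (here refl))
  ... | i , eᵢ≡fᵢ with pair-cover F (λ a b a∈ b∈ → int a b (there (there a∈)) (there (there b∈)))
  ... | C , covers , size = (i , lookup e i) ∷ C , covers′ , s≤s (subst (_≤ suc (suc (length F)))
                                                           (sym (+-suc (length C) (length C))) (s≤s size))
    where
    covers′ : Covers ((i , lookup e i) ∷ C) (e ∷ f ∷ F)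
    covers′ a (here refl) = here refl
    covers′ a (there (here refl)) = here (sym eᵢ≡fᵢ)
    covers′ a (there (there a∈)) = there (covers a a∈)

  cover-number≤half : ∀ F K → Intersecting F → CoverNumberAtLeast F K → K + K ≤ suc (length F)
  cover-number≤half F K int τ≥K with pair-cover F int
  ... | C , covers , size = ≤-trans (+-mono-≤ (τ≥K C covers) (τ≥K C covers)) size

amgm : ∀ a b → 2 * a * b ≤ a * a + b * b
amgm a b with ≤-total a b
... | inj₁ a≤b with m≤n⇒∃[o]m+o≡n a≤b
...   | d , refl = subst (2 * a * (a + d) ≤_) (sym (square a d)) (m≤m+n _ (d * d))
  where
  square : ∀ a d → a * a + (a + d) * (a + d) ≡ 2 * a * (a + d) + d * d
  square = solve-∀
amgm a b | inj₂ b≤a with m≤n⇒∃[o]m+o≡n b≤a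
...   | d , refl = subst₂ _≤_ (comm b d) (sym (square b d)) (m≤m+n _ (d * d))
  where
  square : ∀ b d → (b + d) * (b + d) + b * b ≡ 2 * b * (b + d) + d * d
  square = solve-∀
  comm : ∀ b d → 2 * b * (b + d) ≡ 2 * (b + d) * b
  comm = solve-∀

exceeds-everywhere : ∀ m K t → (m + 1) * (m + 1) + 4 ≤ 4 * (m * K) → m * t + t < t * t + m * K
exceeds-everywhere m K t disc = *-cancelˡ-≤ 4 (begin
  4 * suc (m * t + t)                    ≡⟨ expand₁ m t ⟩
  2 * (2 * t) * (m + 1) + 4              ≤⟨ +-monoˡ-≤ 4 (amgm (2 * t) (m + 1)) ⟩
  2 * t * (2 * t) + (m + 1) * (m + 1) + 4 ≡⟨ +-assoc (2 * t * (2 * t)) _ 4 ⟩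
  2 * t * (2 * t) + ((m + 1) * (m + 1) + 4) ≤⟨ +-monoʳ-≤ (2 * t * (2 * t)) disc ⟩
  2 * t * (2 * t) + 4 * (m * K)          ≡⟨ expand₂ m K t ⟩
  4 * (t * t + m * K)                    ∎)
  where
  open ≤-Reasoning
  expand₁ : ∀ m t → 4 * suc (m * t + t) ≡ 2 * (2 * t) * (m + 1) + 4
  expand₁ = solve-∀
  expand₂ : ∀ m K t → 2 * t * (2 * t) + 4 * (m * K) ≡ 4 * (t * t + m * K)
  expand₂ = solve-∀

-- Past its vertex the same quadratic only grows: if 2t ≥ m + 1 + w then
-- 4(t² − (m + 1)t + mK − 1) ≥ w² + 4mK − (m + 1)² − 4.  This is the criterion
-- used when the discriminant is positive but t is known to be large.
exceeds-past-vertex : ∀ m K t w → m + 1 + w ≤ 2 * t →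
  (m + 1) * (m + 1) + 4 ≤ w * w + 4 * (m * K) → m * t + t < t * t + m * K
exceeds-past-vertex m K t w past value with m≤n⇒∃[o]m+o≡n past
... | u , 2t≡ = *-cancelˡ-≤ 4 (begin
  4 * suc (m * t + t)                          ≡⟨ expand₁ m t ⟩
  2 * (m + 1) * (2 * t) + 4                    ≡⟨ cong (λ s → 2 * (m + 1) * s + 4) (sym 2t≡) ⟩
  2 * (m + 1) * (m + 1 + w + u) + 4            ≡⟨ expand₂ m w u ⟩
  (m + 1) * (m + 1) + 2 * (m + 1) * (w + u) + ((m + 1) * (m + 1) + 4)
    ≤⟨ +-monoʳ-≤ ((m + 1) * (m + 1) + 2 * (m + 1) * (w + u))
         (≤-trans value (+-monoˡ-≤ (4 * (m * K)) (*-mono-≤ (m≤m+n w u) (m≤m+n w u)))) ⟩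
  (m + 1) * (m + 1) + 2 * (m + 1) * (w + u) + ((w + u) * (w + u) + 4 * (m * K))
    ≡⟨ expand₃ m K w u ⟩
  (m + 1 + w + u) * (m + 1 + w + u) + 4 * (m * K) ≡⟨ cong (λ s → s * s + 4 * (m * K)) 2t≡ ⟩
  2 * t * (2 * t) + 4 * (m * K)                 ≡⟨ expand₄ m K t ⟩
  4 * (t * t + m * K)                           ∎)
  where
  open ≤-Reasoning
  expand₁ : ∀ m t → 4 * suc (m * t + t) ≡ 2 * (m + 1) * (2 * t) + 4
  expand₁ = solve-∀
  expand₂ : ∀ m w u → 2 * (m + 1) * (m + 1 + w + u) + 4 ≡
    (m + 1) * (m + 1) + 2 * (m + 1) * (w + u) + ((m + 1) * (m + 1) + 4)
  expand₂ = solve-∀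
  expand₃ : ∀ m K w u → (m + 1) * (m + 1) + 2 * (m + 1) * (w + u) + ((w + u) * (w + u) + 4 * (m * K)) ≡
    (m + 1 + w + u) * (m + 1 + w + u) + 4 * (m * K)
  expand₃ = solve-∀
  expand₄ : ∀ m K t → 2 * t * (2 * t) + 4 * (m * K) ≡ 4 * (t * t + m * K)
  expand₄ = solve-∀

degree-inequality-mono : ∀ r K t D c → D ≤ c → K ≤ t →
  t * t + r * D * K ≤ r * D * t + t → t * t + r * c * K ≤ r * c * t + t
degree-inequality-mono r K t D c D≤c K≤t ineq with m≤n⇒∃[o]m+o≡n D≤c
... | d , refl = begin
  t * t + r * (D + d) * K         ≡⟨ split r K t D d ⟩
  (t * t + r * D * K) + r * d * K ≤⟨ +-mono-≤ ineq (*-monoʳ-≤ (r * d) K≤t) ⟩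
  (r * D * t + t) + r * d * t     ≡⟨ merge r t D d ⟩
  r * (D + d) * t + t             ∎
  where
  open ≤-Reasoning
  split : ∀ r K t D d → t * t + r * (D + d) * K ≡ (t * t + r * D * K) + r * d * K
  split = solve-∀
  merge : ∀ r t D d → (r * D * t + t) + r * d * t ≡ r * (D + d) * t + t
  merge = solve-∀

degree-forced : ∀ r K t D c → K ≤ t → t * t + r * D * K ≤ r * D * t + t →
  r * c * t + t < t * t + r * c * K → c < D
degree-forced r K t D c K≤t ineq violated with c <? D
... | yes c<D = c<D
... | no c≮D = ⊥-elim (<⇒≱ violated (degree-inequality-mono r K t D c (≮⇒≥ c≮D) K≤t ineq))

violated-at-2 : ∀ r K t → 2 ≤ r → r + 2 ≤ K + K → r * 2 * t + t < t * t + r * 2 * K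
violated-at-2 r K t r≥2 phase = exceeds-everywhere (r * 2) K t (begin
  (r * 2 + 1) * (r * 2 + 1) + 4   ≡⟨ expand r ⟩
  4 * (r * r) + 4 * r + 5         ≤⟨ +-monoʳ-≤ (4 * (r * r) + 4 * r) (≤-trans (m≤m+n 5 3) (*-monoʳ-≤ 4 r≥2)) ⟩
  4 * (r * r) + 4 * r + 4 * r     ≡⟨ factor r ⟩
  4 * r * (r + 2)                 ≤⟨ *-monoʳ-≤ (4 * r) phase ⟩
  4 * r * (K + K)                 ≡⟨ regroup r K ⟩
  4 * (r * 2 * K)                 ∎)
  where
  open ≤-Reasoning
  expand : ∀ r → (r * 2 + 1) * (r * 2 + 1) + 4 ≡ 4 * (r * r) + 4 * r + 5
  expand = solve-∀
  factor : ∀ r → 4 * (r * r) + 4 * r + 4 * r ≡ 4 * r * (r + 2)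
  factor = solve-∀
  regroup : ∀ r K → 4 * r * (K + K) ≡ 4 * (r * 2 * K)
  regroup = solve-∀

violated-at-3 : ∀ r K t → 2 ≤ r → 3 * r + 3 ≤ 4 * K → r * 3 * t + t < t * t + r * 3 * K
violated-at-3 r K t r≥2 phase = exceeds-everywhere (r * 3) K t (begin
  (r * 3 + 1) * (r * 3 + 1) + 4   ≡⟨ expand r ⟩
  9 * (r * r) + 6 * r + 5         ≤⟨ +-monoʳ-≤ (9 * (r * r) + 6 * r) (≤-trans (m≤m+n 5 1) (*-monoʳ-≤ 3 r≥2)) ⟩
  9 * (r * r) + 6 * r + 3 * r     ≡⟨ factor r ⟩
  3 * r * (3 * r + 3)             ≤⟨ *-monoʳ-≤ (3 * r) phase ⟩
  3 * r * (4 * K)                 ≡⟨ regroup r K ⟩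
  4 * (r * 3 * K)                 ∎)
  where
  open ≤-Reasoning
  expand : ∀ r → (r * 3 + 1) * (r * 3 + 1) + 4 ≡ 9 * (r * r) + 6 * r + 5
  expand = solve-∀
  factor : ∀ r → 9 * (r * r) + 6 * r + 3 * r ≡ 3 * r * (3 * r + 3)
  factor = solve-∀
  regroup : ∀ r K → 3 * r * (4 * K) ≡ 4 * (r * 3 * K)
  regroup = solve-∀

-- Once 20K ≥ 19r the degree inequality fails for D = 4, so the maximum
-- degree is at least 5.  Here the discriminant is positive; instead, the
-- bound t ≥ 4K − (5r + 16)/4 of the previous phase puts t past the vertex,
-- 2t ≥ 5r + 1, where the quadratic is already positive.
violated-at-4 : ∀ r K t → 100 ≤ r → 19 * r ≤ 20 * K → 16 * K ≤ 4 * t + (5 * r + 16) →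
  r * 4 * t + t < t * t + r * 4 * K
violated-at-4 r K t r≥100 phase bound = exceeds-past-vertex (r * 4) K t r past-vertex value
  where
  open ≤-Reasoning
  past-vertex : r * 4 + 1 + r ≤ 2 * t
  past-vertex = *-cancelˡ-≤ 40 (+-cancelʳ-≤ (100 * r + 320) _ _ (begin
    40 * (r * 4 + 1 + r) + (100 * r + 320) ≡⟨ expand r ⟩
    300 * r + 360                          ≤⟨ +-monoʳ-≤ (300 * r) (≤-trans (m≤m+n 360 40) (*-monoʳ-≤ 4 r≥100)) ⟩
    300 * r + 4 * r                        ≡⟨ factor r ⟩
    16 * (19 * r)                          ≤⟨ *-monoʳ-≤ 16 phase ⟩
    16 * (20 * K)                          ≡⟨ *-comm-20-16 K ⟩
    20 * (16 * K)                          ≤⟨ *-monoʳ-≤ 20 bound ⟩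
    20 * (4 * t + (5 * r + 16))            ≡⟨ distribute r t ⟩
    40 * (2 * t) + (100 * r + 320)         ∎))
    where
    expand : ∀ r → 40 * (r * 4 + 1 + r) + (100 * r + 320) ≡ 300 * r + 360
    expand = solve-∀
    factor : ∀ r → 300 * r + 4 * r ≡ 16 * (19 * r)
    factor = solve-∀
    *-comm-20-16 : ∀ K → 16 * (20 * K) ≡ 20 * (16 * K)
    *-comm-20-16 = solve-∀
    distribute : ∀ r t → 20 * (4 * t + (5 * r + 16)) ≡ 40 * (2 * t) + (100 * r + 320)
    distribute = solve-∀
  value : (r * 4 + 1) * (r * 4 + 1) + 4 ≤ r * r + 4 * (r * 4 * K)
  value = *-cancelˡ-≤ 5 (begin
    5 * ((r * 4 + 1) * (r * 4 + 1) + 4)    ≡⟨ expand r ⟩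
    80 * (r * r) + (40 * r + 25)           ≤⟨ +-monoʳ-≤ (80 * (r * r)) linear≤square ⟩
    80 * (r * r) + r * r                   ≡⟨ factor r ⟩
    5 * (r * r) + 4 * r * (19 * r)         ≤⟨ +-monoʳ-≤ (5 * (r * r)) (*-monoʳ-≤ (4 * r) phase) ⟩
    5 * (r * r) + 4 * r * (20 * K)         ≡⟨ regroup r K ⟩
    5 * (r * r + 4 * (r * 4 * K))          ∎)
    where
    linear≤square : 40 * r + 25 ≤ r * r
    linear≤square = begin
      40 * r + 25    ≤⟨ +-monoʳ-≤ (40 * r) (≤-trans (m≤m+n 25 75) (≤-trans r≥100 (m≤n*m r 60))) ⟩
      40 * r + 60 * r ≡⟨ solve-100 r ⟩
      100 * r        ≤⟨ *-monoˡ-≤ r r≥100 ⟩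
      r * r          ∎
      where
      solve-100 : ∀ r → 40 * r + 60 * r ≡ 100 * r
      solve-100 = solve-∀
    expand : ∀ r → 5 * ((r * 4 + 1) * (r * 4 + 1) + 4) ≡ 80 * (r * r) + (40 * r + 25)
    expand = solve-∀
    factor : ∀ r → 80 * (r * r) + r * r ≡ 5 * (r * r) + 4 * r * (19 * r)
    factor = solve-∀
    regroup : ∀ r K → 5 * (r * r) + 4 * r * (20 * K) ≡ 5 * (r * r + 4 * (r * 4 * K))
    regroup = solve-∀

-- "t ≥ cK − ρ/g", scaled by g to stay within ℕ.
LowerBound : (g c ρ K t : ℕ) → Set
LowerBound g c ρ K t = g * c * K ≤ g * t + ρ

-- Inside a phase each greedy step deletes at least c edges while K grows by
-- one, so a linear lower bound of slope c, once established on entering the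
-- phase, persists.
phase-step : ∀ {Phase : ℕ → Set} → (∀ k → Dec (Phase k)) → ∀ g c ρ k t D →
  (Phase k → LowerBound g c ρ k t) →
  (Phase (suc k) → ¬ Phase k → LowerBound g c ρ (suc k) (D + t)) →
  (Phase (suc k) → c ≤ D) →
  Phase (suc k) → LowerBound g c ρ (suc k) (D + t)
phase-step phase? g c ρ k t D inside entering forced now with phase? k
... | no before = entering now before
... | yes before = begin
  g * c * suc k            ≡⟨ *-suc (g * c) k ⟩
  g * c + g * c * k        ≤⟨ +-mono-≤ (*-monoʳ-≤ g (forced now)) (inside before) ⟩
  g * D + (g * t + ρ)      ≡⟨ +-assoc (g * D) (g * t) ρ ⟨
  g * D + g * t + ρ        ≡⟨ cong (_+ ρ) (*-distribˡ-+ g D t) ⟨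
  g * (D + t) + ρ          ∎
  where open ≤-Reasoning

-- The phases of the greedy process, named after the degree they force.
Phase₃ Phase₄ Phase₅ : ℕ → ℕ → Set
Phase₃ r K = r + 2 ≤ K + K
Phase₄ r K = 3 * r + 3 ≤ 4 * K
Phase₅ r K = 19 * r ≤ 20 * K

phase₄⇒phase₃ : ∀ r K → 1 ≤ r → Phase₄ r K → Phase₃ r K
phase₄⇒phase₃ r K r≥1 phase = *-cancelˡ-≤ 2 (begin
  2 * (r + 2)       ≡⟨ expand r ⟩
  2 * r + 4         ≤⟨ +-monoʳ-≤ (2 * r) (+-monoˡ-≤ 3 r≥1) ⟩
  2 * r + (r + 3)   ≡⟨ regroup r ⟩
  3 * r + 3         ≤⟨ phase ⟩
  4 * K             ≡⟨ double K ⟩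
  2 * (K + K)       ∎)
  where
  open ≤-Reasoning
  expand : ∀ r → 2 * (r + 2) ≡ 2 * r + 4
  expand = solve-∀
  regroup : ∀ r → 2 * r + (r + 3) ≡ 3 * r + 3
  regroup = solve-∀
  double : ∀ K → 4 * K ≡ 2 * (K + K)
  double = solve-∀

phase₅⇒phase₄ : ∀ r K → 4 ≤ r → Phase₅ r K → Phase₄ r K
phase₅⇒phase₄ r K r≥4 phase = *-cancelˡ-≤ 5 (begin
  5 * (3 * r + 3)   ≡⟨ expand r ⟩
  15 * r + 15       ≤⟨ +-monoʳ-≤ (15 * r) (≤-trans (m≤m+n 15 1) (*-monoʳ-≤ 4 r≥4)) ⟩
  15 * r + 4 * r    ≡⟨ regroup r ⟩
  19 * r            ≤⟨ phase ⟩
  20 * K            ≡⟨ regroup′ K ⟩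
  5 * (4 * K)       ∎)
  where
  open ≤-Reasoning
  expand : ∀ r → 5 * (3 * r + 3) ≡ 15 * r + 15
  expand = solve-∀
  regroup : ∀ r → 15 * r + 4 * r ≡ 19 * r
  regroup = solve-∀
  regroup′ : ∀ K → 20 * K ≡ 5 * (4 * K)
  regroup′ = solve-∀

-- The linear lower bounds on t = |F| valid in each phase:
-- t ≥ 3K − (r + 5)/2,  t ≥ 4K − (5r + 16)/4  and  t ≥ 5K − (44r + 100)/20.
Bound₃ Bound₄ Bound₅ : ℕ → ℕ → ℕ → Set
Bound₃ r K t = LowerBound 2 3 (r + 5) K t
Bound₄ r K t = LowerBound 4 4 (5 * r + 16) K t
Bound₅ r K t = LowerBound 20 5 (44 * r + 100) K t

-- Entering phase 3 from below: t ≥ 2K − 1 (pairing) already gives Bound₃.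
enter₃ : ∀ r k t → suc k + suc k ≤ suc t → ¬ Phase₃ r k → Bound₃ r (suc k) t
enter₃ r k t half before = begin
  6 * suc k                            ≡⟨ split k ⟩
  suc (suc (k + k)) + 2 * (suc k + suc k) ≤⟨ +-mono-≤ (s≤s (≰⇒> before)) (*-monoʳ-≤ 2 half) ⟩
  suc (r + 2) + 2 * suc t              ≡⟨ regroup r t ⟩
  2 * t + (r + 5)                      ∎
  where
  open ≤-Reasoning
  split : ∀ k → 6 * suc k ≡ suc (suc (k + k)) + 2 * (suc k + suc k)
  split = solve-∀
  regroup : ∀ r t → suc (r + 2) + 2 * suc t ≡ 2 * t + (r + 5)
  regroup = solve-∀

enter₄ : ∀ r k t → Bound₃ r (suc k) t → ¬ Phase₄ r k → Bound₄ r (suc k) t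
enter₄ r k t bound₃ before = begin
  16 * suc k                           ≡⟨ split k ⟩
  2 * (6 * suc k) + (suc (4 * k) + 3)  ≤⟨ +-mono-≤ (*-monoʳ-≤ 2 bound₃) (+-monoˡ-≤ 3 (≰⇒> before)) ⟩
  2 * (2 * t + (r + 5)) + (3 * r + 3 + 3) ≡⟨ regroup r t ⟩
  4 * t + (5 * r + 16)                 ∎
  where
  open ≤-Reasoning
  split : ∀ k → 16 * suc k ≡ 2 * (6 * suc k) + (suc (4 * k) + 3)
  split = solve-∀
  regroup : ∀ r t → 2 * (2 * t + (r + 5)) + (3 * r + 3 + 3) ≡ 4 * t + (5 * r + 16)
  regroup = solve-∀

enter₅ : ∀ r k t → Bound₄ r (suc k) t → ¬ Phase₅ r k → Bound₅ r (suc k) t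
enter₅ r k t bound₄ before = begin
  100 * suc k                          ≡⟨ split k ⟩
  5 * (16 * suc k) + (suc (20 * k) + 19) ≤⟨ +-mono-≤ (*-monoʳ-≤ 5 bound₄) (+-monoˡ-≤ 19 (≰⇒> before)) ⟩
  5 * (4 * t + (5 * r + 16)) + (19 * r + 19) ≡⟨ regroup r t ⟩
  20 * t + (44 * r + 99)               ≤⟨ +-monoʳ-≤ (20 * t) (+-monoʳ-≤ (44 * r) (n≤1+n 99)) ⟩
  20 * t + (44 * r + 100)              ∎
  where
  open ≤-Reasoning
  split : ∀ k → 100 * suc k ≡ 5 * (16 * suc k) + (suc (20 * k) + 19)
  split = solve-∀
  regroup : ∀ r t → 5 * (4 * t + (5 * r + 16)) + (19 * r + 19) ≡ 20 * t + (44 * r + 99)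
  regroup = solve-∀

Invariant : ℕ → ℕ → ℕ → Set
Invariant r K t = (Phase₃ r K → Bound₃ r K t) × (Phase₄ r K → Bound₄ r K t) × (Phase₅ r K → Bound₅ r K t)

invariant-start : ∀ r t → 1 ≤ r → Invariant r 0 t
invariant-start r t r≥1 =
  (λ phase → ⊥-elim (positive (≤-trans (m≤n+m 2 r) phase))) ,
  (λ phase → ⊥-elim (positive (≤-trans (m≤n+m 3 (3 * r)) phase))) ,
  (λ phase → ⊥-elim (positive (≤-trans (*-monoʳ-≤ 19 r≥1) phase)))
  where
  positive : ∀ {n} → suc n ≤ 0 → ⊥
  positive ()

invariant-step : ∀ r k t t′ D → 100 ≤ r → t ≡ D + t′ → Invariant r k t′ →
  t * t + r * D * suc k ≤ r * D * t + t → suc k + suc k ≤ suc t → Invariant r (suc k) t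
invariant-step r k t t′ D r≥100 refl (inside₃ , inside₄ , inside₅) ineq half = bound₃ , bound₄ , bound₅
  where
  K = suc k
  r≥4 : 4 ≤ r
  r≥4 = ≤-trans (m≤m+n 4 96) r≥100
  K≤t : K ≤ t
  K≤t = ≤-trans (m≤n+m K k) (≤-pred half)
  forced : ∀ c → r * c * t + t < t * t + r * c * K → c < D
  forced c = degree-forced r K t D c K≤t ineq
  bound₃ : Phase₃ r K → Bound₃ r K t
  bound₃ = phase-step (λ j → r + 2 ≤? j + j) 2 3 (r + 5) k t′ D inside₃
    (λ _ before → enter₃ r k t half before)
    (λ now → forced 2 (violated-at-2 r K t (≤-trans (m≤m+n 2 2) r≥4) now))
  bound₄ : Phase₄ r K → Bound₄ r K t
  bound₄ = phase-step (λ j → 3 * r + 3 ≤? 4 * j) 4 4 (5 * r + 16) k t′ D inside₄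
    (λ now → enter₄ r k t (bound₃ (phase₄⇒phase₃ r K (≤-trans (s≤s z≤n) r≥4) now)))
    (λ now → forced 3 (violated-at-3 r K t (≤-trans (m≤m+n 2 2) r≥4) now))
  bound₅ : Phase₅ r K → Bound₅ r K t
  bound₅ = phase-step (λ j → 19 * r ≤? 20 * j) 20 5 (44 * r + 100) k t′ D inside₅
    (λ now → enter₅ r k t (bound₄ (phase₅⇒phase₄ r K r≥4 now)))
    (λ now → forced 4 (violated-at-4 r K t r≥100 now (bound₄ (phase₅⇒phase₄ r K r≥4 now))))

greedy-invariant : ∀ {r} → 100 ≤ r → ∀ K (F : Hypergraph r) → Intersecting F →
  CoverNumberAtLeast F K → Invariant r K (length F)
greedy-invariant {r} r≥100 zero F _ _ = invariant-start r (length F) (≤-trans (s≤s z≤n) r≥100)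
greedy-invariant {r} r≥100 (suc k) F int τ≥ with nonempty F k τ≥
... | e₀ , e₀∈ with max-vertex F int e₀∈
... | v , max =
  invariant-step r k (length F) (length (F ∖ v)) (deg v F) r≥100 (∖-size F v)
    (greedy-invariant r≥100 k (F ∖ v) (∖-intersecting F v int) (∖-cover F v k τ≥))
    (degree-inequality F (deg v F) (suc k) int τ≥ max)
    (cover-number≤half F (suc k) int τ≥)

-- At the end of the process, K = r − 1 lies in phase 5, where
-- 100K ≤ 20t + 44r + 100 yields t ≥ 2.8r − 10 ≥ 2.77r.
many-edges : ∀ r t → 400 ≤ r → Invariant r (r ∸ 1) t → 277 * r ≤ 100 * t
many-edges (suc r) t (s≤s r≥399) (_ , _ , inside₅) = +-cancelʳ-≤ (5 * (44 * suc r + 100)) _ _ (begin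
  277 * suc r + 5 * (44 * suc r + 100) ≡⟨ expand r ⟩
  497 * r + 997                        ≤⟨ +-monoʳ-≤ (497 * r) (≤-trans (m≤m+n 997 200) (*-monoʳ-≤ 3 r≥399)) ⟩
  497 * r + 3 * r                      ≡⟨ regroup r ⟩
  5 * (20 * 5 * r)                     ≤⟨ *-monoʳ-≤ 5 (inside₅ reached) ⟩
  5 * (20 * t + (44 * suc r + 100))    ≡⟨ distribute r t ⟩
  100 * t + 5 * (44 * suc r + 100)     ∎)
  where
  open ≤-Reasoning
  reached : Phase₅ (suc r) r
  reached = begin
    19 * suc r      ≡⟨ *-suc 19 r ⟩
    19 + 19 * r     ≤⟨ +-monoˡ-≤ (19 * r) (≤-trans (m≤m+n 19 380) r≥399) ⟩
    r + 19 * r      ≡⟨ solve-20 r ⟩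
    20 * r          ∎
    where
    solve-20 : ∀ r → r + 19 * r ≡ 20 * r
    solve-20 = solve-∀
  expand : ∀ r → 277 * suc r + 5 * (44 * suc r + 100) ≡ 497 * r + 997
  expand = solve-∀
  regroup : ∀ r → 497 * r + 3 * r ≡ 5 * (20 * 5 * r)
  regroup = solve-∀
  distribute : ∀ r t → 5 * (20 * t + (44 * suc r + 100)) ≡ 100 * t + 5 * (44 * suc r + 100)
  distribute = solve-∀

square-cancel-< : ∀ x y → x * x < y * y → x < y
square-cancel-< x y x²<y² = ≰⇒> (λ y≤x → <⇒≱ x²<y² (*-mono-≤ y≤x y≤x))

-- a/b < 3 − 1/√18 < 2.77: from b² < 18c² with c = 3b − a we get 23b < 100c
-- (as 23² · 18 < 100²), hence 100a < 277b.
ratio-bound : ∀ a b → a < 3 * b → b * b < 18 * ((3 * b ∸ a) * (3 * b ∸ a)) → 100 * a ≤ 277 * b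
ratio-bound a b a<3b disc = +-cancelʳ-≤ (23 * b) (100 * a) (277 * b) (begin
  100 * a + 23 * b        ≤⟨ +-monoʳ-≤ (100 * a) (<⇒≤ 23b<100c) ⟩
  100 * a + 100 * c       ≡⟨ *-distribˡ-+ 100 a c ⟨
  100 * (a + c)           ≡⟨ cong (100 *_) (m+[n∸m]≡n (<⇒≤ a<3b)) ⟩
  100 * (3 * b)           ≡⟨ split b ⟩
  277 * b + 23 * b        ∎)
  where
  open ≤-Reasoning
  c = 3 * b ∸ a
  23b<100c : 23 * b < 100 * c
  23b<100c = square-cancel-< (23 * b) (100 * c) (begin-strict
    23 * b * (23 * b)       ≡⟨ square₁ b ⟩
    529 * (b * b)           <⟨ *-monoʳ-< 529 disc ⟩
    529 * (18 * (c * c))    ≡⟨ square₂ c ⟩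
    9522 * (c * c)          ≤⟨ *-monoˡ-≤ (c * c) (m≤m+n 9522 478) ⟩
    10000 * (c * c)         ≡⟨ square₃ c ⟩
    100 * c * (100 * c)     ∎)
    where
    square₁ : ∀ b → 23 * b * (23 * b) ≡ 529 * (b * b)
    square₁ = solve-∀
    square₂ : ∀ c → 529 * (18 * (c * c)) ≡ 9522 * (c * c)
    square₂ = solve-∀
    square₃ : ∀ c → 10000 * (c * c) ≡ 100 * c * (100 * c)
    square₃ = solve-∀
  split : ∀ b → 100 * (3 * b) ≡ 277 * b + 23 * b
  split = solve-∀

scale : ∀ a b r t → 100 * a ≤ 277 * b → 277 * r ≤ 100 * t → a * r ≤ b * t
scale a b r t 100a≤277b 277r≤100t = *-cancelˡ-≤ 100 (begin
  100 * (a * r)    ≡⟨ *-assoc 100 a r ⟨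
  100 * a * r      ≤⟨ *-monoˡ-≤ r 100a≤277b ⟩
  277 * b * r      ≡⟨ swap b r ⟩
  b * (277 * r)    ≤⟨ *-monoʳ-≤ b 277r≤100t ⟩
  b * (100 * t)    ≡⟨ swap′ b t ⟩
  100 * (b * t)    ∎)
  where
  open ≤-Reasoning
  swap : ∀ b r → 277 * b * r ≡ b * (277 * r)
  swap = solve-∀
  swap′ : ∀ b t → b * (100 * t) ≡ 100 * (b * t)
  swap′ = solve-∀

theorem1p2 : ∀ (a b : ℕ) → a < 3 * b → b * b < 18 * ((3 * b ∸ a) * (3 * b ∸ a)) →
    ∃[ R ] (∀ (r : ℕ) → R ≤ r → (H : Hypergraph r) → Unique H → Intersecting H →
      CoverNumberAtLeast H (r ∸ 1) → a * r ≤ b * length H)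
theorem1p2 a b a<3b disc = 400 , λ r r≥400 H _ int τ≥r-1 →
  scale a b r (length H) (ratio-bound a b a<3b disc)
    (many-edges r (length H) r≥400
      (greedy-invariant (≤-trans (m≤m+n 100 300) r≥400) (r ∸ 1) H int τ≥r-1))
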